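{- Let $\pi\in S_n(1423)$ with $\pi\neq n(n-1)\ldots1$, let $\phi(\pi)=(a,b)$, $m=a+\rho(\pi)+1$, $l=n-a-\rho(\pi)$, and write $\operatorname{RLmax}\pi=\{i_1<\dots<i_s<a\}\cup[b,n]$. Let $\sigma\in S_m$ and $\alpha\in S_l$ satisfy $\operatorname{RLmax}\sigma=\{i_1<\dots<i_s<a\}\cup[a+1,m]$ and $\operatorname{RLmax}\alpha=[b-a,l]$, and let $\sigma'=\sigma(\alpha,a+1)$. If $$\operatorname{Des}\sigma=\{i\in\operatorname{Des}\pi:1\le i\le a\}\cup[a+1,m-1]\quad\text{and}\quad \operatorname{Des}\alpha=\{i-a:i\in\operatorname{Des}\pi,\ a<i<b\}\cup[b-a,l-1],$$ then $\operatorname{Des}\sigma'=\operatorname{Des}\pi$.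
   Context: $[x,y]=\{x,\dots,y\}$ (empty if $x>y$). $S_n(1423)$ is the set of permutations in $S_n$ with no subsequence order-isomorphic to $1423$. $\operatorname{Des}\pi=\{i:\pi_i>\pi_{i+1}\}$. $\operatorname{RLmax}\pi$ is the set of indices $i$ with $\pi_i>\pi_j$ for all $j>i$. For $\pi\ne n(n-1)\ldots1$, $\phi(\pi)=(a,b)$: $b$ is the smallest index with $[b,n]\subseteq\operatorname{RLmax}\pi$; $a=0$ if $\operatorname{RLmax}\pi=[b,n]$, otherwise $a=\max(\operatorname{RLmax}\pi\setminus[b,n])$. $\chi(\pi)=\max\{\pi_i:a<i<b\}$ and $\rho(\pi)=|\{i\in\operatorname{RLmax}\pi:i>b,\ \pi_i>\chi(\pi)\}|$. The notation $\{i_1<\dots<i_s<a\}$ denotes the set $\{i_1,\dots,i_s,a\}$ of the listed indices (when $a=0$ it contributes nothing). Inflation: for $\sigma\in S_m$, $\alpha\in S_l$ and $1\le a+1\le m$, $\sigma(\alpha,a+1)$ is $\hat\sigma_1\ldots\hat\sigma_a\,\hat\alpha_1\ldots\hat\alpha_l\,\hat\sigma_{a+2}\ldots\hat\sigma_m$, where $\hat\alpha_i=\alpha_i+\sigma_{a+1}-1$, and $\hat\sigma_i=\sigma_i$ if $\sigma_i<\sigma_{a+1}$, $\hat\sigma_i=\sigma_i+l-1$ otherwise. -}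

module Defs where

open import Data.Nat using (ℕ; zero; suc; _+_; _∸_; _≤_; _<_; _⊔_; _<?_; _≤?_)
open import Data.List using (List; []; _∷_; map; filter; length; take; drop; _++_; upTo; foldr; reverse)
open import Data.List.Membership.Propositional using (_∈_)
open import Data.List.Relation.Unary.All using (All; all?)
open import Data.List.Relation.Binary.Permutation.Propositional using (_↭_)
open import Data.Product using (Σ; _×_)
open import Data.Sum using (_⊎_)
open import Data.Bool using (if_then_else_)
open import Relation.Nullary using (¬_; does)
open import Relation.Nullary.Decidable using (_×-dec_)
open import Relation.Binary.PropositionalEquality using (_≡_)

-- Conventions: a permutation of length n is the list of its values π₁ … πₙ;
-- positions and values are 1-based. Sets of indices are represented as
-- strictly increasing lists of indices.

-- [x,y] = {x,…,y} as an increasing list (empty if x > y)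
range : ℕ → ℕ → List ℕ
range x y = map (x +_) (upTo (suc y ∸ x))

IsPerm : ℕ → List ℕ → Set
IsPerm n π = π ↭ range 1 n

decr : ℕ → List ℕ
decr n = reverse (range 1 n)

-- π_i (1-based; 0 outside [1, length π])
at : List ℕ → ℕ → ℕ
at [] _ = 0
at (x ∷ xs) zero = 0
at (x ∷ xs) (suc zero) = x
at (x ∷ xs) (suc (suc i)) = at xs (suc i)

Contains1423 : List ℕ → Set
Contains1423 π = Σ ℕ λ i → Σ ℕ λ j → Σ ℕ λ k → Σ ℕ λ l →
  1 ≤ i × i < j × j < k × k < l × l ≤ length π ×
  at π i < at π k × at π k < at π l × at π l < at π j

Avoids1423 : List ℕ → Set
Avoids1423 π = ¬ Contains1423 π

Des : List ℕ → List ℕ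
Des π = filter (λ i → at π (suc i) <? at π i) (range 1 (length π ∸ 1))

RLmax : List ℕ → List ℕ
RLmax π = filter (λ i → all? (λ j → at π j <? at π i) (range (suc i) (length π)))
                 (range 1 (length π))

IsPhiB : List ℕ → ℕ → Set
IsPhiB π b =
  1 ≤ b × b ≤ length π ×
  (∀ j → b ≤ j → j ≤ length π → j ∈ RLmax π) ×
  (∀ c → 1 ≤ c → c ≤ length π →
     (∀ j → c ≤ j → j ≤ length π → j ∈ RLmax π) → b ≤ c)

IsPhi : List ℕ → ℕ → ℕ → Set
IsPhi π a b = IsPhiB π b ×
  ((a ≡ 0 × (∀ i → i ∈ RLmax π → b ≤ i))
   ⊎ (a ∈ RLmax π × a < b × (∀ i → i ∈ RLmax π → i < b → i ≤ a)))

chi : List ℕ → ℕ → ℕ → ℕ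
chi π a b = foldr _⊔_ 0 (map (at π) (range (suc a) (b ∸ 1)))

rho : List ℕ → ℕ → ℕ → ℕ
rho π a b = length (filter (λ i → (b <? i) ×-dec (chi π a b <? at π i)) (RLmax π))

inflate : List ℕ → List ℕ → ℕ → List ℕ
inflate σ α a =
  map hat (take a σ) ++ map (λ x → x + v ∸ 1) α ++ map hat (drop (suc a) σ)
  where
  v = at σ (suc a)
  hat : ℕ → ℕ
  hat x = if does (x <? v) then x else x + length α ∸ 1

-- Inflation keeps the relative order inside σ (through σ̂) and inside α (a shift by
-- σ_{a+1} − 1), and the values of the inflated block lie above every σ̂-value below
-- σ_{a+1} and below every σ̂-value above it. So the descents of σ(α, a+1) are the
-- descents of σ up to a, the descents of α shifted by a, and the descents of σ from
-- a+1 on shifted by l − 1. The hypothesis on Des σ matches the first part with Des π;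
-- the one on Des α matches the second, since π descends everywhere on [b, n] ⊆ RLmax π;
-- after the block σ descends by hypothesis and π does because the block ends at or after b,
-- which is the counting bound ρ(π) ≤ n − b.

module Submission where

open import Defs
open import Data.Nat using (ℕ; suc; _+_; _∸_; _≤?_; _<?_)
open import Data.List using (List; filter; map; _++_)
open import Relation.Nullary.Decidable using (_×-dec_)
open import Relation.Binary.PropositionalEquality using (_≡_; _≢_)

open import Data.Nat
open import Data.Nat.Properties
open import Level using (0ℓ)
open import Data.Bool using (if_then_else_)
open import Data.Empty using (⊥-elim)
open import Data.List using (List; []; _∷_; [_]; length; take; drop; applyUpTo)
open import Data.List.Properties
  using ( length-map; length-take; length-drop; length-++; length-applyUpTo
        ; map-applyUpTo; applyUpTo-∷ʳ; filter-++)
open import Data.List.Membership.Propositional using (_∈_)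
open import Data.List.Membership.Propositional.Properties
  using (∈-map⁺; ∈-map⁻; ∈-upTo⁺; ∈-upTo⁻; ∈-filter⁺; ∈-filter⁻; ∈-++⁺ˡ; ∈-++⁺ʳ; ∈-++⁻)
open import Data.List.Relation.Unary.Any using (here; there)
open import Data.List.Relation.Unary.AllPairs using (_∷_)
import Data.List.Relation.Unary.All as All
open import Data.List.Relation.Unary.Unique.Propositional using (Unique)
import Data.List.Relation.Unary.Unique.Propositional.Properties as Unique
open import Data.List.Relation.Binary.Permutation.Propositional using (↭-sym; ↭⇒↭ₛ)
open import Data.List.Relation.Binary.Permutation.Propositional.Properties using (↭-length; ∈-resp-↭)
import Data.List.Relation.Binary.Permutation.Setoid.Properties as Perm
open import Data.List.Relation.Binary.Sublist.Propositional.Properties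
  using (filter-⊆; filter⁺; length-mono-≤)
open import Data.Product using (_×_; _,_; proj₁; proj₂)
open import Data.Sum using (inj₁; inj₂)
open import Function using (_∘_; _⇔_; mk⇔; Equivalence)
import Function.Properties.Equivalence as ⇔
open import Relation.Binary.Definitions using (tri<; tri≈; tri>)
open import Relation.Nullary using (Dec; yes; no; does)
open import Relation.Nullary.Decidable using (dec-true; dec-false)
open import Relation.Unary using (Pred; Decidable)
open import Relation.Binary.PropositionalEquality
  using (refl; sym; trans; cong; cong₂; subst; subst₂; ≢-sym; setoid; module ≡-Reasoning)

open Equivalence using (to; from)

∈-range⁻ : ∀ {x y i} → i ∈ range x y → x ≤ i × i ≤ y
∈-range⁻ {x} {y} p with ∈-map⁻ (x +_) p
... | k , k∈ , refl =
  m≤m+n x k , ≤-pred (subst (_≤ suc y) (cong suc (+-comm k x)) (m≤o∸n⇒m+n≤o (suc k) x≤1+y k<))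
  where
  k< : k < suc y ∸ x
  k< = ∈-upTo⁻ k∈
  x≤1+y : x ≤ suc y
  x≤1+y = <⇒≤ (m∸n≢0⇒n<m (λ e → n≮0 (subst (k <_) e k<)))

∈-range⁺ : ∀ {x y i} → x ≤ i → i ≤ y → i ∈ range x y
∈-range⁺ {x} {y} x≤i i≤y =
  subst (_∈ range x y) (m+[n∸m]≡n x≤i) (∈-map⁺ (x +_) (∈-upTo⁺ (∸-monoˡ-< (s≤s i≤y) x≤i)))

range1≡applyUpTo : ∀ n → range 1 n ≡ applyUpTo suc n
range1≡applyUpTo = map-applyUpTo (λ i → i) suc

length-range1 : ∀ n → length (range 1 n) ≡ n
length-range1 n = trans (cong length (range1≡applyUpTo n)) (length-applyUpTo suc n)

length-filter>-range1 : ∀ b n → length (filter (b <?_) (range 1 n)) ≡ n ∸ b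
length-filter>-range1 b zero = sym (0∸n≡0 b)
length-filter>-range1 b (suc n) = begin
  length (filter (b <?_) (range 1 (suc n)))
    ≡⟨ cong (length ∘ filter (b <?_)) (trans (range1≡applyUpTo (suc n)) (sym (applyUpTo-∷ʳ suc n))) ⟩
  length (filter (b <?_) (applyUpTo suc n ++ [ suc n ]))
    ≡⟨ cong length (filter-++ (b <?_) (applyUpTo suc n) [ suc n ]) ⟩
  length (filter (b <?_) (applyUpTo suc n) ++ filter (b <?_) [ suc n ])
    ≡⟨ length-++ (filter (b <?_) (applyUpTo suc n)) ⟩
  length (filter (b <?_) (applyUpTo suc n)) + length (filter (b <?_) [ suc n ])
    ≡⟨ cong (_+ length (filter (b <?_) [ suc n ]))
            (trans (cong (length ∘ filter (b <?_)) (sym (range1≡applyUpTo n))) (length-filter>-range1 b n)) ⟩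
  n ∸ b + length (filter (b <?_) [ suc n ])
    ≡⟨ last-entry (b <? suc n) ⟩
  suc n ∸ b ∎
  where
  open ≡-Reasoning
  last-entry : Dec (b < suc n) → n ∸ b + length (filter (b <?_) [ suc n ]) ≡ suc n ∸ b
  last-entry (yes b<1+n) rewrite dec-true (b <? suc n) b<1+n =
    trans (+-comm (n ∸ b) 1) (sym (+-∸-assoc 1 (≤-pred b<1+n)))
  last-entry (no b≮1+n) rewrite dec-false (b <? suc n) b≮1+n =
    trans (+-identityʳ (n ∸ b)) (trans (m≤n⇒m∸n≡0 (≤-trans (n≤1+n n) 1+n≤b)) (sym (m≤n⇒m∸n≡0 1+n≤b)))
    where
    1+n≤b : suc n ≤ b
    1+n≤b = ≮⇒≥ b≮1+n

at-zero : ∀ (xs : List ℕ) → at xs 0 ≡ 0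
at-zero []      = refl
at-zero (_ ∷ _) = refl

at-cons : ∀ x (xs : List ℕ) {k} → 1 ≤ k → at (x ∷ xs) (suc k) ≡ at xs k
at-cons x xs {suc k} _ = refl

at-++ˡ : ∀ (xs ys : List ℕ) {j} → j ≤ length xs → at (xs ++ ys) j ≡ at xs j
at-++ˡ []       ys       {zero}        _         = at-zero ys
at-++ˡ (x ∷ xs) ys       {zero}        _         = refl
at-++ˡ (x ∷ xs) ys       {suc zero}    _         = refl
at-++ˡ (x ∷ xs) ys       {suc (suc j)} (s≤s j<) = at-++ˡ xs ys j<

at-++ʳ : ∀ (xs ys : List ℕ) {n j} → length xs ≡ n → 1 ≤ j → at (xs ++ ys) (n + j) ≡ at ys j
at-++ʳ []       ys refl 1≤j = refl
at-++ʳ (x ∷ xs) ys {j = j} refl 1≤j =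
  trans (at-cons x (xs ++ ys) (≤-trans 1≤j (m≤n+m j (length xs)))) (at-++ʳ xs ys refl 1≤j)

at-map : ∀ (f : ℕ → ℕ) (xs : List ℕ) {j} → 1 ≤ j → j ≤ length xs → at (map f xs) j ≡ f (at xs j)
at-map f (x ∷ xs) {suc zero}    _ _         = refl
at-map f (x ∷ xs) {suc (suc j)} _ (s≤s j<) = at-map f xs (s≤s z≤n) j<

at-take : ∀ a (xs : List ℕ) {j} → j ≤ a → at (take a xs) j ≡ at xs j
at-take a       xs       {zero}        _         = trans (at-zero (take a xs)) (sym (at-zero xs))
at-take (suc a) []       {suc j}       _         = refl
at-take (suc a) (x ∷ xs) {suc zero}    _         = refl
at-take (suc a) (x ∷ xs) {suc (suc j)} (s≤s j≤) = at-take a xs j≤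

at-drop : ∀ k (xs : List ℕ) {j} → 1 ≤ j → at (drop k xs) j ≡ at xs (k + j)
at-drop zero    xs       _   = refl
at-drop (suc k) []       _   = refl
at-drop (suc k) (x ∷ xs) {j} 1≤j =
  trans (at-drop k xs 1≤j) (sym (at-cons x xs (≤-trans 1≤j (m≤n+m j k))))

at-∈ : ∀ (xs : List ℕ) {j} → 1 ≤ j → j ≤ length xs → at xs j ∈ xs
at-∈ (x ∷ xs) {suc zero}    _ _         = here refl
at-∈ (x ∷ xs) {suc (suc j)} _ (s≤s j<) = there (at-∈ xs (s≤s z≤n) j<)

at-distinct : ∀ {xs : List ℕ} → Unique xs →
  ∀ {i} → 1 ≤ i → suc i ≤ length xs → at xs i ≢ at xs (suc i)
at-distinct {x ∷ xs} (x∉ ∷ u) {suc zero}    _ (s≤s 1≤) = All.lookup x∉ (at-∈ xs (s≤s z≤n) 1≤)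
at-distinct {x ∷ xs} (_ ∷ u)  {suc (suc i)} _ (s≤s i<) = at-distinct u (s≤s z≤n) i<

length-IsPerm : ∀ {n π} → IsPerm n π → length π ≡ n
length-IsPerm {n} p = trans (↭-length p) (length-range1 n)

IsPerm⇒Unique : ∀ {n π} → IsPerm n π → Unique π
IsPerm⇒Unique {n} p =
  Perm.Unique-resp-↭ (setoid ℕ) (↭⇒↭ₛ (↭-sym p)) (Unique.map⁺ (+-cancelˡ-≡ 1 _ _) (Unique.upTo⁺ n))

at-IsPerm : ∀ {n π} → IsPerm n π → ∀ {j} → 1 ≤ j → j ≤ length π → 1 ≤ at π j × at π j ≤ n
at-IsPerm p 1≤j j≤ = ∈-range⁻ (∈-resp-↭ p (at-∈ _ 1≤j j≤))

filter-cong-∈ : ∀ {P Q : Pred ℕ 0ℓ} (P? : Decidable P) (Q? : Decidable Q) (xs : List ℕ) →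
  (∀ {x} → x ∈ xs → P x ⇔ Q x) → filter P? xs ≡ filter Q? xs
filter-cong-∈ P? Q? []       P⇔Q = refl
filter-cong-∈ P? Q? (x ∷ xs) P⇔Q with P? x | Q? x
... | yes _  | yes _  = cong (x ∷_) (filter-cong-∈ P? Q? xs (P⇔Q ∘ there))
... | no  _  | no  _  = filter-cong-∈ P? Q? xs (P⇔Q ∘ there)
... | yes Px | no ¬Qx = ⊥-elim (¬Qx (to (P⇔Q (here refl)) Px))
... | no ¬Px | yes Qx = ⊥-elim (¬Px (from (P⇔Q (here refl)) Qx))

Descent : List ℕ → ℕ → Set
Descent p i = at p (suc i) < at p i

≤∸1⇒< : ∀ {i n} → 1 ≤ i → i ≤ n ∸ 1 → i < n
≤∸1⇒< {suc i} {suc n} _ i≤ = s≤s i≤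

∈-Des⁻ : ∀ p {i} → i ∈ Des p → 1 ≤ i × suc i ≤ length p × Descent p i
∈-Des⁻ p i∈ with ∈-filter⁻ (λ i → at p (suc i) <? at p i) {xs = range 1 (length p ∸ 1)} i∈
... | i∈range , d with ∈-range⁻ i∈range
...   | 1≤i , i≤ = 1≤i , ≤∸1⇒< 1≤i i≤ , d

∈-Des⁺ : ∀ p {i} → 1 ≤ i → suc i ≤ length p → Descent p i → i ∈ Des p
∈-Des⁺ p 1≤i i< d = ∈-filter⁺ (λ i → at p (suc i) <? at p i) (∈-range⁺ 1≤i (∸-monoˡ-≤ 1 i<)) d

Des-cong : ∀ {p q} → length p ≡ length q →
  (∀ {i} → 1 ≤ i → suc i ≤ length q → Descent p i ⇔ Descent q i) → Des p ≡ Des q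
Des-cong {p} {q} p≡q agree =
  trans (cong (λ N → filter (λ i → at p (suc i) <? at p i) (range 1 (N ∸ 1))) p≡q)
        (filter-cong-∈ _ _ (range 1 (length q ∸ 1)) λ i∈ →
          let 1≤i , i≤ = ∈-range⁻ i∈ in agree 1≤i (≤∸1⇒< 1≤i i≤))

RLmax-descent : ∀ π {i} → i ∈ RLmax π → suc i ≤ length π → Descent π i
RLmax-descent π {i} i∈ i< =
  All.lookup (proj₂ (∈-filter⁻ right-maximal? {xs = range 1 (length π)} i∈)) (∈-range⁺ ≤-refl i<)
  where
  right-maximal? : Decidable (λ i → All.All (λ j → at π j < at π i) (range (suc i) (length π)))
  right-maximal? i = All.all? (λ j → at π j <? at π i) (range (suc i) (length π))

rho≤length∸ : ∀ π a b → rho π a b ≤ length π ∸ b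
rho≤length∸ π a b = begin
  rho π a b
    ≤⟨ length-mono-≤ (filter⁺ (λ i → (b <? i) ×-dec (chi π a b <? at π i)) (b <?_)
                        (λ { refl → proj₁ }) (filter-⊆ _ (range 1 (length π)))) ⟩
  length (filter (b <?_) (range 1 (length π)))
    ≡⟨ length-filter>-range1 b (length π) ⟩
  length π ∸ b ∎
  where open ≤-Reasoning

hatσ : ℕ → ℕ → ℕ → ℕ
hatσ v L x = if does (x <? v) then x else x + L ∸ 1

hatα : ℕ → ℕ → ℕ
hatα v x = x + v ∸ 1

module HatOrder (v L : ℕ) (1≤L : 1 ≤ L) where

  data HatσView (x : ℕ) : Set where
    below : x < v → hatσ v L x ≡ x → HatσView x
    above : v ≤ x → hatσ v L x ≡ x + (L ∸ 1) → HatσView x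

  hatσ-view : ∀ x → HatσView x
  hatσ-view x = view (x <? v)
    where
    hatσ-by : ∀ {b} → does (x <? v) ≡ b → hatσ v L x ≡ (if b then x else x + L ∸ 1)
    hatσ-by = cong (λ b → if b then x else x + L ∸ 1)
    view : Dec (x < v) → HatσView x
    view (yes x<v) = below x<v (hatσ-by (dec-true (x <? v) x<v))
    view (no  x≮v) = above (≮⇒≥ x≮v) (trans (hatσ-by (dec-false (x <? v) x≮v)) (+-∸-assoc x 1≤L))

  hatσ-mono-< : ∀ {x y} → x < y → hatσ v L x < hatσ v L y
  hatσ-mono-< {x} {y} x<y with hatσ-view x | hatσ-view y
  ... | below _   ex | below _ ey rewrite ex | ey = x<y
  ... | below _   ex | above _ ey rewrite ex | ey = <-≤-trans x<y (m≤m+n y (L ∸ 1))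
  ... | above v≤x _  | below y<v _ = ⊥-elim (<-irrefl refl (<-≤-trans (<-trans x<y y<v) v≤x))
  ... | above _   ex | above _ ey rewrite ex | ey = +-monoˡ-< (L ∸ 1) x<y

  hatσ-<-⇔ : ∀ {x y} → hatσ v L x < hatσ v L y ⇔ x < y
  hatσ-<-⇔ {x} {y} = mk⇔ reflect hatσ-mono-<
    where
    reflect : hatσ v L x < hatσ v L y → x < y
    reflect h with <-cmp x y
    ... | tri< x<y _ _ = x<y
    ... | tri≈ _ refl _ = ⊥-elim (<-irrefl refl h)
    ... | tri> _ _ y<x = ⊥-elim (<-asym h (hatσ-mono-< y<x))

  hatσ<v : ∀ {y} → y < v → hatσ v L y < v
  hatσ<v {y} y<v with hatσ-view y
  ... | below _ ey = subst (_< v) (sym ey) y<v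
  ... | above v≤y _ = ⊥-elim (<-irrefl refl (<-≤-trans y<v v≤y))

  v+L≤hatσ : ∀ {y} → v < y → v + L ≤ hatσ v L y
  v+L≤hatσ {y} v<y with hatσ-view y
  ... | below y<v _ = ⊥-elim (<-asym y<v v<y)
  ... | above _ ey = begin
    v + L             ≡⟨ cong (v +_) (m+[n∸m]≡n 1≤L) ⟨
    v + suc (L ∸ 1)   ≡⟨ +-suc v (L ∸ 1) ⟩
    suc v + (L ∸ 1)   ≤⟨ +-monoˡ-≤ (L ∸ 1) v<y ⟩
    y + (L ∸ 1)       ≡⟨ sym ey ⟩
    hatσ v L y        ∎
    where open ≤-Reasoning

  v≤hatα : ∀ {x} → 1 ≤ x → v ≤ hatα v x
  v≤hatα {suc x} _ = m≤n+m v x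

  hatα<v+L : ∀ {x} → 1 ≤ x → x ≤ L → hatα v x < v + L
  hatα<v+L {suc x} _ x<L = subst (x + v <_) (+-comm L v) (+-monoˡ-< v x<L)

  hatα-<-⇔ : ∀ {x y} → 1 ≤ x → 1 ≤ y → hatα v x < hatα v y ⇔ x < y
  hatα-<-⇔ {suc x} {suc y} _ _ = mk⇔ (λ h → s≤s (+-cancelʳ-< v x y h)) (λ x<y → +-monoˡ-< v (≤-pred x<y))

  hatσ<hatα-⇔ : ∀ {x y} → 1 ≤ x → x ≤ L → y ≢ v → hatσ v L y < hatα v x ⇔ y < v
  hatσ<hatα-⇔ {x} {y} 1≤x x≤L y≢v = mk⇔ to′ (λ y<v → <-≤-trans (hatσ<v y<v) (v≤hatα 1≤x))
    where
    to′ : hatσ v L y < hatα v x → y < v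
    to′ h with <-cmp y v
    ... | tri< y<v _ _ = y<v
    ... | tri≈ _ y≡v _ = ⊥-elim (y≢v y≡v)
    ... | tri> _ _ v<y = ⊥-elim (<-asym h (<-≤-trans (hatα<v+L 1≤x x≤L) (v+L≤hatσ v<y)))

  hatα<hatσ-⇔ : ∀ {x y} → 1 ≤ x → x ≤ L → y ≢ v → hatα v x < hatσ v L y ⇔ v < y
  hatα<hatσ-⇔ {x} {y} 1≤x x≤L y≢v = mk⇔ to′ (λ v<y → <-≤-trans (hatα<v+L 1≤x x≤L) (v+L≤hatσ v<y))
    where
    to′ : hatα v x < hatσ v L y → v < y
    to′ h with <-cmp y v
    ... | tri< y<v _ _ = ⊥-elim (<-asym h (<-≤-trans (hatσ<v y<v) (v≤hatα 1≤x)))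
    ... | tri≈ _ y≡v _ = ⊥-elim (y≢v y≡v)
    ... | tri> _ _ v<y = v<y

Descent-via : ∀ p i {x y} → at p (suc i) ≡ x → at p i ≡ y → Descent p i ⇔ x < y
Descent-via p i refl refl = ⇔.refl

module Inflation (σ α : List ℕ) (a r : ℕ)
  (σ-perm : IsPerm (a + r + 1) σ) (α-perm : IsPerm (length α) α) (α-nonempty : 1 ≤ length α) where

  v : ℕ
  v = at σ (suc a)

  L : ℕ
  L = length α

  left block right : List ℕ
  left  = map (hatσ v L) (take a σ)
  block = map (hatα v) α
  right = map (hatσ v L) (drop (suc a) σ)

  σ′ : List ℕ
  σ′ = inflate σ α a

  open HatOrder v L α-nonempty

  length-σ : length σ ≡ suc (a + r)
  length-σ = trans (length-IsPerm σ-perm) (+-comm (a + r) 1)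

  length-take-σ : length (take a σ) ≡ a
  length-take-σ =
    trans (length-take a σ) (m≤n⇒m⊓n≡m (subst (a ≤_) (sym length-σ) (≤-trans (m≤m+n a r) (n≤1+n _))))

  length-left : length left ≡ a
  length-left = trans (length-map (hatσ v L) (take a σ)) length-take-σ

  length-block : length block ≡ L
  length-block = length-map (hatα v) α

  length-drop-σ : length (drop (suc a) σ) ≡ r
  length-drop-σ = trans (length-drop (suc a) σ) (trans (cong (_∸ suc a) length-σ) (m+n∸m≡n a r))

  length-right : length right ≡ r
  length-right = trans (length-map (hatσ v L) (drop (suc a) σ)) length-drop-σ

  length-inflate : length σ′ ≡ a + L + r
  length-inflate = begin
    length (left ++ block ++ right)              ≡⟨ length-++ left ⟩
    length left + length (block ++ right)        ≡⟨ cong (length left +_) (length-++ block) ⟩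
    length left + (length block + length right)  ≡⟨ cong₂ _+_ length-left
                                                             (cong₂ _+_ length-block length-right) ⟩
    a + (L + r)                                  ≡⟨ +-assoc a L r ⟨
    a + L + r                                    ∎
    where open ≡-Reasoning

  at-inflate-σˡ : ∀ {i} → 1 ≤ i → i ≤ a → at σ′ i ≡ hatσ v L (at σ i)
  at-inflate-σˡ {i} 1≤i i≤a = begin
    at (left ++ block ++ right) i  ≡⟨ at-++ˡ left _ (subst (i ≤_) (sym length-left) i≤a) ⟩
    at left i                      ≡⟨ at-map (hatσ v L) (take a σ) 1≤i (subst (i ≤_) (sym length-take-σ) i≤a) ⟩
    hatσ v L (at (take a σ) i)     ≡⟨ cong (hatσ v L) (at-take a σ i≤a) ⟩
    hatσ v L (at σ i)              ∎
    where open ≡-Reasoning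

  at-inflate-α : ∀ {j} → 1 ≤ j → j ≤ L → at σ′ (a + j) ≡ hatα v (at α j)
  at-inflate-α {j} 1≤j j≤L = begin
    at (left ++ block ++ right) (a + j)  ≡⟨ at-++ʳ left _ length-left 1≤j ⟩
    at (block ++ right) j                ≡⟨ at-++ˡ block _ (subst (j ≤_) (sym length-block) j≤L) ⟩
    at block j                           ≡⟨ at-map (hatα v) α 1≤j j≤L ⟩
    hatα v (at α j)                      ∎
    where open ≡-Reasoning

  at-inflate-σʳ : ∀ {k} → 1 ≤ k → k ≤ r → at σ′ (a + L + k) ≡ hatσ v L (at σ (suc a + k))
  at-inflate-σʳ {k} 1≤k k≤r = begin
    at σ′ (a + L + k)                   ≡⟨ cong (at σ′) (+-assoc a L k) ⟩
    at (left ++ block ++ right) (a + (L + k))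
                                        ≡⟨ at-++ʳ left _ length-left (≤-trans 1≤k (m≤n+m k L)) ⟩
    at (block ++ right) (L + k)         ≡⟨ at-++ʳ block _ length-block 1≤k ⟩
    at right k                          ≡⟨ at-map (hatσ v L) (drop (suc a) σ) 1≤k
                                                  (subst (k ≤_) (sym length-drop-σ) k≤r) ⟩
    hatσ v L (at (drop (suc a) σ) k)    ≡⟨ cong (hatσ v L) (at-drop (suc a) σ 1≤k) ⟩
    hatσ v L (at σ (suc a + k))         ∎
    where open ≡-Reasoning

  α-entry : ∀ {j} → 1 ≤ j → j ≤ L → 1 ≤ at α j × at α j ≤ L
  α-entry = at-IsPerm α-perm

  σ-adjacent-distinct : ∀ {i} → 1 ≤ i → i ≤ a + r → at σ i ≢ at σ (suc i)
  σ-adjacent-distinct 1≤i i≤ =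
    at-distinct (IsPerm⇒Unique σ-perm) 1≤i (subst (suc _ ≤_) (sym length-σ) (s≤s i≤))

  descentˡ : ∀ {i} → 1 ≤ i → suc i ≤ a → Descent σ′ i ⇔ Descent σ i
  descentˡ 1≤i i<a =
    ⇔.trans (Descent-via σ′ _ (at-inflate-σˡ (s≤s z≤n) i<a) (at-inflate-σˡ 1≤i (<⇒≤ i<a))) hatσ-<-⇔

  descent-entry : 1 ≤ a → Descent σ′ a ⇔ Descent σ a
  descent-entry 1≤a =
    ⇔.trans (Descent-via σ′ _ (trans (cong (at σ′) (+-comm 1 a)) (at-inflate-α ≤-refl α-nonempty))
                         (at-inflate-σˡ 1≤a ≤-refl))
            (hatα<hatσ-⇔ 1≤α₁ α₁≤L (σ-adjacent-distinct 1≤a (m≤m+n a r)))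
    where
    1≤α₁ : 1 ≤ at α 1
    1≤α₁ = proj₁ (α-entry ≤-refl α-nonempty)
    α₁≤L : at α 1 ≤ L
    α₁≤L = proj₂ (α-entry ≤-refl α-nonempty)

  descent-α : ∀ {j} → 1 ≤ j → suc j ≤ L → Descent σ′ (a + j) ⇔ Descent α j
  descent-α {j} 1≤j j<L =
    ⇔.trans (Descent-via σ′ _ (trans (cong (at σ′) (sym (+-suc a j))) (at-inflate-α (s≤s z≤n) j<L))
                         (at-inflate-α 1≤j (<⇒≤ j<L)))
            (hatα-<-⇔ (proj₁ (α-entry (s≤s z≤n) j<L)) (proj₁ (α-entry 1≤j (<⇒≤ j<L))))

  descent-exit : 1 ≤ r → Descent σ′ (a + L) ⇔ Descent σ (suc a)
  descent-exit 1≤r =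
    ⇔.trans (Descent-via σ′ _ (trans (cong (at σ′) (+-comm 1 (a + L)))
                                (trans (at-inflate-σʳ ≤-refl 1≤r) (cong (hatσ v L ∘ at σ) (+-comm (suc a) 1))))
                         (at-inflate-α α-nonempty ≤-refl))
            (hatσ<hatα-⇔ 1≤αL αL≤L (≢-sym (σ-adjacent-distinct (s≤s z≤n) (m<m+n a 1≤r))))
    where
    1≤αL : 1 ≤ at α L
    1≤αL = proj₁ (α-entry α-nonempty ≤-refl)
    αL≤L : at α L ≤ L
    αL≤L = proj₂ (α-entry α-nonempty ≤-refl)

  descentʳ : ∀ {k} → 1 ≤ k → suc k ≤ r → Descent σ′ (a + L + k) ⇔ Descent σ (suc a + k)
  descentʳ {k} 1≤k k<r =
    ⇔.trans (Descent-via σ′ _ (trans (cong (at σ′) (sym (+-suc (a + L) k)))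
                                (trans (at-inflate-σʳ (s≤s z≤n) k<r) (cong (hatσ v L ∘ at σ) (+-suc (suc a) k))))
                         (at-inflate-σʳ 1≤k (<⇒≤ k<r)))
            hatσ-<-⇔

  descent-tail : (∀ {i} → suc a ≤ i → i ≤ a + r → Descent σ i) →
    ∀ k → suc k ≤ r → Descent σ′ (a + L + k)
  descent-tail σ-tail zero 1≤r =
    subst (Descent σ′) (sym (+-identityʳ (a + L))) (from (descent-exit 1≤r) (σ-tail ≤-refl (m<m+n a 1≤r)))
  descent-tail σ-tail (suc k) k<r =
    from (descentʳ (s≤s z≤n) k<r)
         (σ-tail (m≤m+n (suc a) (suc k)) (subst (_≤ a + r) (+-suc a (suc k)) (+-monoʳ-≤ a k<r)))

  Des-inflate : (π : List ℕ) → length π ≡ a + L + r →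
    (∀ {i} → 1 ≤ i → i ≤ a → suc i ≤ length σ → suc i ≤ length π → Descent σ i ⇔ Descent π i) →
    (∀ {j} → 1 ≤ j → suc j ≤ L → suc (a + j) ≤ length π → Descent α j ⇔ Descent π (a + j)) →
    (∀ {i} → suc a ≤ i → i ≤ a + r → Descent σ i) →
    (∀ {i} → a + L ≤ i → suc i ≤ length π → Descent π i) →
    Des σ′ ≡ Des π
  Des-inflate π length-π σ≈π α≈π σ-tail π-tail =
    Des-cong {σ′} {π} (trans length-inflate (sym length-π)) agree
    where
    σ-bound : ∀ {i} → i ≤ a → suc i ≤ length σ
    σ-bound i≤a = subst (suc _ ≤_) (sym length-σ) (s≤s (≤-trans i≤a (m≤m+n a r)))

    after-α : ∀ k → suc (a + L + k) ≤ length π → Descent σ′ (a + L + k) ⇔ Descent π (a + L + k)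
    after-α k i< = mk⇔ (λ _ → π-tail (m≤m+n (a + L) k) i<) (λ _ → descent-tail σ-tail k k<r)
      where
      k<r : suc k ≤ r
      k<r = +-cancelˡ-≤ (a + L) (suc k) r
              (subst₂ _≤_ (sym (+-suc (a + L) k)) length-π i<)

    after-a : ∀ j → 1 ≤ j → suc (a + j) ≤ length π → Descent σ′ (a + j) ⇔ Descent π (a + j)
    after-a j 1≤j i< with j <? L
    ... | yes j<L = ⇔.trans (descent-α 1≤j j<L) (α≈π 1≤j j<L i<)
    ... | no  j≮L with m≤n⇒∃[o]m+o≡n (≮⇒≥ j≮L)
    ...   | k , refl = subst (λ t → Descent σ′ t ⇔ Descent π t) (+-assoc a L k)
                         (after-α k (subst (λ t → suc t ≤ length π) (sym (+-assoc a L k)) i<))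

    agree : ∀ {i} → 1 ≤ i → suc i ≤ length π → Descent σ′ i ⇔ Descent π i
    agree {i} 1≤i i< with <-cmp i a
    ... | tri< i<a _ _  = ⇔.trans (descentˡ 1≤i i<a) (σ≈π 1≤i (<⇒≤ i<a) (σ-bound (<⇒≤ i<a)) i<)
    ... | tri≈ _ refl _ = ⇔.trans (descent-entry 1≤i) (σ≈π 1≤i ≤-refl (σ-bound ≤-refl) i<)
    ... | tri> _ _ a<i with m≤n⇒∃[o]m+o≡n (<⇒≤ a<i)
    ...   | zero  , refl = ⊥-elim (<-irrefl (sym (+-identityʳ a)) a<i)
    ...   | suc j , refl = after-a (suc j) (s≤s z≤n) i<

range⊆Des : ∀ p xs {x y i} → Des p ≡ xs ++ range x y → x ≤ i → i ≤ y → Descent p i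
range⊆Des p xs Des-p x≤i i≤y =
  proj₂ (proj₂ (∈-Des⁻ p (subst (_ ∈_) (sym Des-p) (∈-++⁺ʳ xs (∈-range⁺ x≤i i≤y)))))

Des-prefix-⇔ : ∀ p q {a y i} → Des p ≡ filter (_≤? a) (Des q) ++ range (suc a) y →
  1 ≤ i → i ≤ a → suc i ≤ length p → suc i ≤ length q → Descent p i ⇔ Descent q i
Des-prefix-⇔ p q {a} {y} {i} Des-p 1≤i i≤a i<p i<q = mk⇔ to′ from′
  where
  to′ : Descent p i → Descent q i
  to′ d with ∈-++⁻ (filter (_≤? a) (Des q)) (subst (i ∈_) Des-p (∈-Des⁺ p 1≤i i<p d))
  ... | inj₁ i∈ = proj₂ (proj₂ (∈-Des⁻ q (proj₁ (∈-filter⁻ (_≤? a) i∈))))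
  ... | inj₂ i∈ = ⊥-elim (<-irrefl refl (<-≤-trans (s≤s i≤a) (proj₁ (∈-range⁻ i∈))))
  from′ : Descent q i → Descent p i
  from′ d = proj₂ (proj₂ (∈-Des⁻ p (subst (i ∈_) (sym Des-p)
              (∈-++⁺ˡ (∈-filter⁺ (_≤? a) (∈-Des⁺ q 1≤i i<q d) i≤a)))))

Des-window-⇔ : ∀ p q {a b y j} →
  Des p ≡ map (_∸ a) (filter (λ i → (a <? i) ×-dec (i <? b)) (Des q)) ++ range (b ∸ a) y →
  (∀ {i} → b ≤ i → suc i ≤ length q → Descent q i) →
  1 ≤ j → suc j ≤ length p → j ≤ y → suc (a + j) ≤ length q → Descent p j ⇔ Descent q (a + j)
Des-window-⇔ p q {a} {b} {y} {j} Des-p q-tail 1≤j j<p j≤y a+j<q = mk⇔ to′ from′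
  where
  window? : Decidable (λ i → a < i × i < b)
  window? i = (a <? i) ×-dec (i <? b)

  to′ : Descent p j → Descent q (a + j)
  to′ d with ∈-++⁻ (map (_∸ a) (filter window? (Des q))) (subst (j ∈_) Des-p (∈-Des⁺ p 1≤j j<p d))
  ... | inj₂ j∈ = q-tail (≤-trans (m≤n+m∸n b a) (+-monoʳ-≤ a (proj₁ (∈-range⁻ j∈)))) a+j<q
  ... | inj₁ j∈ with ∈-map⁻ (_∸ a) j∈
  ...   | i , i∈ , refl with ∈-filter⁻ window? {xs = Des q} i∈
  ...     | i∈Des , a<i , _ =
    subst (Descent q) (sym (m+[n∸m]≡n (<⇒≤ a<i))) (proj₂ (proj₂ (∈-Des⁻ q i∈Des)))

  from′ : Descent q (a + j) → Descent p j
  from′ d = proj₂ (proj₂ (∈-Des⁻ p (subst (j ∈_) (sym Des-p) j∈)))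
    where
    j∈ : j ∈ map (_∸ a) (filter window? (Des q)) ++ range (b ∸ a) y
    j∈ with a + j <? b
    ... | yes a+j<b = ∈-++⁺ˡ (subst (_∈ map (_∸ a) (filter window? (Des q))) (m+n∸m≡n a j)
                        (∈-map⁺ (_∸ a) (∈-filter⁺ window? (∈-Des⁺ q (≤-trans 1≤j (m≤n+m j a)) a+j<q d)
                                                   (m<m+n a 1≤j , a+j<b))))
    ... | no  a+j≮b =
      ∈-++⁺ʳ _ (∈-range⁺ (subst (b ∸ a ≤_) (m+n∸m≡n a j) (∸-monoˡ-≤ a (≮⇒≥ a+j≮b))) j≤y)

block-decomposition : ∀ {n a b r} → a < b → b ≤ n → r ≤ n ∸ b →
  n ≡ a + (n ∸ a ∸ r) + r × b ≤ a + (n ∸ a ∸ r)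
block-decomposition {n} {a} {b} {r} a<b b≤n r≤n∸b = n≡ , b≤
  where
  open ≡-Reasoning
  a+r≤n : a + r ≤ n
  a+r≤n = ≤-trans (+-mono-≤ (<⇒≤ a<b) r≤n∸b) (≤-reflexive (m+[n∸m]≡n b≤n))
  n≡ : n ≡ a + (n ∸ a ∸ r) + r
  n≡ = begin
    n                         ≡⟨ m+[n∸m]≡n a+r≤n ⟨
    a + r + (n ∸ (a + r))     ≡⟨ cong (a + r +_) (∸-+-assoc n a r) ⟨
    a + r + (n ∸ a ∸ r)       ≡⟨ +-assoc a r _ ⟩
    a + (r + (n ∸ a ∸ r))     ≡⟨ cong (a +_) (+-comm r _) ⟩
    a + ((n ∸ a ∸ r) + r)     ≡⟨ +-assoc a _ r ⟨
    a + (n ∸ a ∸ r) + r       ∎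
  b≤ : b ≤ a + (n ∸ a ∸ r)
  b≤ = subst (b ≤_) (trans (cong (_∸ r) n≡) (m+n∸n≡m _ r))
         (m+n≤o⇒m≤o∸n b (≤-trans (+-monoʳ-≤ b r≤n∸b) (≤-reflexive (m+[n∸m]≡n b≤n))))

IsPhi⇒a<b : ∀ π {a b} → IsPhi π a b → a < b
IsPhi⇒a<b _ ((1≤b , _) , inj₁ (refl , _)) = 1≤b
IsPhi⇒a<b _ (_ , inj₂ (_ , a<b , _))      = a<b

IsPhiB⇒descent : ∀ π {b} → IsPhiB π b → ∀ {i} → b ≤ i → suc i ≤ length π → Descent π i
IsPhiB⇒descent π (_ , _ , tail⊆RLmax , _) b≤i i< = RLmax-descent π (tail⊆RLmax _ b≤i (<⇒≤ i<)) i<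

lemma6 : (n : ℕ) (π : List ℕ) → IsPerm n π → Avoids1423 π → π ≢ decr n →
  (a b : ℕ) → IsPhi π a b →
  (σ α : List ℕ) →
  IsPerm (a + rho π a b + 1) σ →
  IsPerm (n ∸ a ∸ rho π a b) α →
  RLmax σ ≡ filter (λ i → i ≤? a) (RLmax π) ++ range (suc a) (a + rho π a b + 1) →
  RLmax α ≡ range (b ∸ a) (n ∸ a ∸ rho π a b) →
  Des σ ≡ filter (λ i → i ≤? a) (Des π) ++ range (suc a) (a + rho π a b + 1 ∸ 1) →
  Des α ≡ map (λ i → i ∸ a) (filter (λ i → (a <? i) ×-dec (i <? b)) (Des π))
            ++ range (b ∸ a) (n ∸ a ∸ rho π a b ∸ 1) →
  Des (inflate σ α a) ≡ Des π
lemma6 n π π-perm _ _ a b φ σ α σ-perm α-perm _ _ Des-σ Des-α =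
  Inflation.Des-inflate σ α a r σ-perm (subst (λ m → IsPerm m α) (sym length-α) α-perm) 1≤α π
    (trans length-π (trans n≡ (cong (λ m → a + m + r) (sym length-α))))
    (Des-prefix-⇔ σ π Des-σ)
    (λ 1≤j j<α → Des-window-⇔ α π Des-α π-tail 1≤j j<α (∸-monoˡ-≤ 1 (subst (suc _ ≤_) length-α j<α)))
    (λ {i} a<i i≤ → range⊆Des σ _ Des-σ a<i (subst (i ≤_) (sym (m+n∸n≡m (a + r) 1)) i≤))
    (λ a+α≤i → π-tail (≤-trans b≤a+l (subst (λ m → a + m ≤ _) length-α a+α≤i)))
  where
  r l : ℕ
  r = rho π a b
  l = n ∸ a ∸ r
  length-π : length π ≡ n
  length-π = length-IsPerm π-perm
  length-α : length α ≡ l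
  length-α = length-IsPerm α-perm
  a<b : a < b
  a<b = IsPhi⇒a<b π φ
  b≤n : b ≤ n
  b≤n = subst (b ≤_) length-π (proj₁ (proj₂ (proj₁ φ)))
  decomposition : n ≡ a + l + r × b ≤ a + l
  decomposition = block-decomposition a<b b≤n (subst (λ m → r ≤ m ∸ b) length-π (rho≤length∸ π a b))
  n≡ : n ≡ a + l + r
  n≡ = proj₁ decomposition
  b≤a+l : b ≤ a + l
  b≤a+l = proj₂ decomposition
  1≤α : 1 ≤ length α
  1≤α = subst (1 ≤_) (sym length-α) (+-cancelˡ-≤ a 1 l (subst (_≤ a + l) (+-comm 1 a) (<-≤-trans a<b b≤a+l)))
  π-tail : ∀ {i} → b ≤ i → suc i ≤ length π → Descent π i
  π-tail = IsPhiB⇒descent π (proj₁ φ)
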